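{- Let $m\ge 1$ and $n\ge 2(m+1)$ be integers. For any non-empty independent set $I$ of $C_n^m$: if $|I|\ge 2$ then $\gamma_{gr}(C_n^m,I)=n-|I|m$, and if $|I|=1$ then $\gamma_{gr}(C_n^m,I)=n-2m$.
   Context: $C_n$ has vertex set $[n]$ and edges $\{i,i+1\}$ (indices mod $n$); $C_n^m$ is its $m$-th power (two vertices adjacent iff their distance in $C_n$ is at most $m$). For a sequence $S=(v_1,\dots,v_k)$ of distinct vertices, $PN_S(v_i)=N[v_i]\setminus\bigcup_{j<i}N[v_j]$; $S$ is a legal dominating sequence if $\{v_1,\dots,v_k\}$ dominates the graph and each $PN_S(v_i)\neq\emptyset$. The footprinter $f_S(x)$ of a vertex $x$ is the unique $v_i$ with $x\in PN_S(v_i)$; $I_S=\{x: f_S(x)=x\}$. For an independent set $I$, $\gamma_{gr}(G,I)=\max\{|S|: S \text{ legal dominating sequence of } G,\ I_S=I\}$ (with $\max\emptyset=-\infty$). -}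

module Defs where

open import Data.Nat using (ℕ; _≤_; _∸_; ∣_-_∣; _⊓_)
open import Data.Fin as Fin using (Fin; toℕ)
open import Data.Fin.Subset using (Subset; _∈_)
open import Data.List using (List; length; lookup)
open import Data.List.Relation.Unary.Unique.Propositional using (Unique)
open import Data.Product using (Σ; ∃; ∃-syntax; _×_)
open import Relation.Binary.PropositionalEquality using (_≡_; _≢_)
open import Relation.Nullary using (¬_)
open import Function.Bundles using (_⇔_)

-- distance in the cycle C_n on vertex set Fin n (vertices 0..n-1, edges {i,i+1} mod n)
cdist : (n : ℕ) → Fin n → Fin n → ℕ
cdist n i j = ∣ toℕ i - toℕ j ∣ ⊓ (n ∸ ∣ toℕ i - toℕ j ∣)

Adj : (n m : ℕ) → Fin n → Fin n → Set
Adj n m x y = x ≢ y × cdist n x y ≤ m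

InN : (n m : ℕ) → Fin n → Fin n → Set
InN n m v x = cdist n v x ≤ m

InPN : (n m : ℕ) (S : List (Fin n)) → Fin (length S) → Fin n → Set
InPN n m S i x = InN n m (lookup S i) x × (∀ (j : Fin (length S)) → j Fin.< i → ¬ InN n m (lookup S j) x)

LegalDom : (n m : ℕ) → List (Fin n) → Set
LegalDom n m S =
  Unique S
  × (∀ (x : Fin n) → ∃[ i ] InN n m (lookup S i) x)
  × (∀ (i : Fin (length S)) → ∃[ x ] InPN n m S i x)

-- x ∈ I_S, i.e. f_S(x) = x (the footprinter of x is x itself)
InIS : (n m : ℕ) (S : List (Fin n)) → Fin n → Set
InIS n m S x = ∃[ i ] (InPN n m S i x × lookup S i ≡ x)

ISEq : (n m : ℕ) (S : List (Fin n)) → Subset n → Set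
ISEq n m S I = ∀ (x : Fin n) → (x ∈ I) ⇔ InIS n m S x

Independent : (n m : ℕ) → Subset n → Set
Independent n m I = ∀ (x y : Fin n) → x ∈ I → y ∈ I → ¬ Adj n m x y

GrundyEq : (n m : ℕ) → Subset n → ℕ → Set
GrundyEq n m I k =
  (∃[ S ] (LegalDom n m S × ISEq n m S I × length S ≡ k))
  × (∀ (S : List (Fin n)) → LegalDom n m S → ISEq n m S I → length S ≤ k)

module Submission where

-- Upper bounds count private neighbours. Give every entry of a legal dominating sequence S with
-- I_S = I a private neighbour, the entry itself when it lies in I. If I = {x}, the first entry is x
-- and its 2m neighbours are further private neighbours of it, so |S| + 2m ≤ n. If |I| ≥ 2, let y be
-- the I-vertex following x ∈ I along the cycle. The first entry of S in the arc from x to y is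
-- undominated when it is played, so it lies in I and is x or y; its m neighbours strictly inside the
-- arc are further private neighbours of it. Arcs of distinct x are disjoint, so |S| + |I|m ≤ n.
--
-- Both bounds are attained: for I = {x} by the n − 2m consecutive vertices starting at x, and for
-- |I| ≥ 2 by a sequence whose omitted vertices are charged, at most m each, to the vertices of I.

open import Defs
open import Algebra.Properties.CommutativeSemigroup using (xy∙z≈xz∙y)
open import Data.Bool using (true; false)
open import Data.Empty using (⊥; ⊥-elim)
open import Data.Fin as Fin using (Fin; zero; suc; toℕ; fromℕ<)
import Data.Fin.Properties as Finₚ
open import Data.Fin.Properties using (+↔⊎; *↔×)
open import Data.Fin.Subset using (Subset; _∈_; _∉_; ∣_∣)
open import Data.Fin.Subset.Properties using (_∈?_)
open import Data.List using (List; length; lookup; applyUpTo; filter; _++_)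
open import Data.List.Membership.Propositional using () renaming (_∈_ to _∈ₗ_)
open import Data.List.Membership.Propositional.Properties using (∈-lookup; ∈-applyUpTo⁺; ∈-filter⁺; ∈-++⁺ˡ; ∈-++⁺ʳ)
open import Data.List.Properties using (length-applyUpTo; lookup-applyUpTo)
open import Data.List.Relation.Unary.All as All using (All)
import Data.List.Relation.Unary.All.Properties as Allₚ
open import Data.List.Relation.Unary.AllPairs as AllPairs using (AllPairs; _∷_)
import Data.List.Relation.Unary.AllPairs.Properties as AllPairsₚ
open import Data.List.Relation.Unary.Any as Any using ()
open import Data.List.Relation.Unary.Any.Properties using (lookup-index)
open import Data.List.Relation.Unary.Unique.Propositional using (Unique)
import Data.List.Relation.Unary.Unique.Propositional.Properties as Uniqueₚ
open import Data.Nat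
open import Data.Nat.DivMod using (_%_; m%n<n; m<n⇒m%n≡m; [m+n]%n≡m%n; m≤n⇒[n∸m]%m≡n%m; %-distribˡ-+)
open import Data.Nat.Properties
open import Data.Nat.Tactic.RingSolver using (solve-∀)
open import Data.Product using (Σ; ∃; _×_; _,_; proj₁; proj₂)
open import Data.Sum using (_⊎_; inj₁; inj₂)
open import Data.Sum.Function.Propositional using (_⊎-↔_)
open import Data.Vec using (_∷_)
open import Data.Vec.Base using (here; there)
open import Function.Bundles using (Equivalence; mk⇔; Injection; _↔_)
open import Function.Properties.Inverse using (↔-refl; ↔-trans; ↔-sym; ↔⇒↣)
open import Relation.Binary.Definitions using (tri<; tri≈; tri>)
open import Relation.Binary.PropositionalEquality
open import Relation.Nullary using (Dec; yes; no; ¬_)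
open import Relation.Nullary.Decidable using (_×-dec_; _⊎-dec_; ¬?)

AllPairs-lookup : ∀ {A : Set} {R : A → A → Set} {xs : List A} → AllPairs R xs →
                  ∀ {i j} → i Fin.< j → R (lookup xs i) (lookup xs j)
AllPairs-lookup (px ∷ _) {zero} {suc j} _ = All.lookup px (∈-lookup j)
AllPairs-lookup (_ ∷ pxs) {suc i} {suc j} (s≤s i<j) = AllPairs-lookup pxs i<j

Unique-lookup-injective : ∀ {A : Set} {xs : List A} → Unique xs → ∀ {i j} → lookup xs i ≡ lookup xs j → i ≡ j
Unique-lookup-injective u {i} {j} eq with Finₚ.<-cmp i j
... | tri< i<j _ _ = ⊥-elim (AllPairs-lookup u i<j eq)
... | tri≈ _ i≡j _ = i≡j
... | tri> _ _ j<i = ⊥-elim (AllPairs-lookup u j<i (sym eq))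

argmin : ∀ {k} (P : Fin k → Set) → (∀ z → Dec (P z)) → (f : Fin k → ℕ) → ∃ P →
         ∃ λ y → P y × (∀ z → P z → f y ≤ f z)
argmin {suc k} P P? f (z₀ , pz₀) with Finₚ.any? (λ z → P? (suc z))
... | no none = zero , P-zero z₀ pz₀ , zero-min
  where
  P-zero : ∀ z → P z → P zero
  P-zero zero pz = pz
  P-zero (suc z) pz = ⊥-elim (none (z , pz))
  zero-min : ∀ z → P z → f zero ≤ f z
  zero-min zero _ = ≤-refl
  zero-min (suc z) pz = ⊥-elim (none (z , pz))
... | yes some with argmin (λ z → P (suc z)) (λ z → P? (suc z)) (λ z → f (suc z)) some
... | y , py , y-min with P? zero
... | no ¬p0 = suc y , py , λ { zero p0 → ⊥-elim (¬p0 p0) ; (suc z) pz → y-min z pz }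
... | yes p0 with f zero ≤? f (suc y)
... | yes f0≤fy = zero , p0 , λ { zero _ → ≤-refl ; (suc z) pz → ≤-trans f0≤fy (y-min z pz) }
... | no f0≰fy = suc y , py , λ { zero _ → <⇒≤ (≰⇒> f0≰fy) ; (suc z) pz → y-min z pz }

first-index : ∀ {k} → Fin k → Σ (Fin k) λ z → ∀ (j : Fin k) → ¬ j Fin.< z
first-index {suc k} _ = zero , λ j ()

Cells : ℕ → ℕ → ℕ → Set
Cells a k m = Fin a ⊎ (Fin k × Fin m)

Cells↔ : ∀ {a k m} → Fin (a + k * m) ↔ Cells a k m
Cells↔ = ↔-trans +↔⊎ (↔-refl ⊎-↔ *↔×)

Cells-injection⇒≤ : ∀ {a k m n} (f : Cells a k m → Fin n) → (∀ {c c'} → f c ≡ f c' → c ≡ c') → a + k * m ≤ n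
Cells-injection⇒≤ f f-inj = Finₚ.injective⇒≤ (λ eq → Injection.injective (↔⇒↣ Cells↔) (f-inj eq))

injection-Cells⇒≤ : ∀ {a k m n} (f : Fin n → Cells a k m) → (∀ {x y} → f x ≡ f y → x ≡ y) → n ≤ a + k * m
injection-Cells⇒≤ f f-inj = Finₚ.injective⇒≤ (λ eq → f-inj (Injection.injective (↔⇒↣ (↔-sym Cells↔)) eq))

element : ∀ {n} (p : Subset n) → Fin ∣ p ∣ → Fin n
element (true ∷ p) zero = zero
element (true ∷ p) (suc c) = suc (element p c)
element (false ∷ p) c = suc (element p c)

element-∈ : ∀ {n} (p : Subset n) c → element p c ∈ p
element-∈ (true ∷ p) zero = here
element-∈ (true ∷ p) (suc c) = there (element-∈ p c)
element-∈ (false ∷ p) c = there (element-∈ p c)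

element-injective : ∀ {n} (p : Subset n) {c c'} → element p c ≡ element p c' → c ≡ c'
element-injective (true ∷ p) {zero} {zero} _ = refl
element-injective (true ∷ p) {suc c} {suc c'} eq = cong suc (element-injective p (Finₚ.suc-injective eq))
element-injective (false ∷ p) eq = element-injective p (Finₚ.suc-injective eq)

element-surjective : ∀ {n} (p : Subset n) {x} → x ∈ p → ∃ λ c → element p c ≡ x
element-surjective (true ∷ p) {zero} here = zero , refl
element-surjective (true ∷ p) {suc x} (there x∈p) with element-surjective p x∈p
... | c , eq = suc c , cong suc eq
element-surjective (false ∷ p) {suc x} (there x∈p) with element-surjective p x∈p
... | c , eq = c , cong suc eq

∣p∣≡1⇒singleton : ∀ {n} {p : Subset n} → ∣ p ∣ ≡ 1 → ∃ λ x → x ∈ p × (∀ {z} → z ∈ p → z ≡ x)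
∣p∣≡1⇒singleton {p = p} ∣p∣≡1 = element p c₀ , element-∈ p c₀ , λ z∈p →
  trans (sym (proj₂ (element-surjective p z∈p))) (cong (element p) (Finₚ.toℕ-injective (trans (toℕ≡0 _) (sym (toℕ≡0 c₀)))))
  where
  toℕ≡0 : ∀ (c : Fin ∣ p ∣) → toℕ c ≡ 0
  toℕ≡0 c = n<1⇒n≡0 (subst (toℕ c <_) ∣p∣≡1 (Finₚ.toℕ<n c))
  c₀ : Fin ∣ p ∣
  c₀ = fromℕ< (subst (0 <_) (sym ∣p∣≡1) (s≤s z≤n))

2≤∣p∣⇒another : ∀ {n} {p : Subset n} → 2 ≤ ∣ p ∣ → ∀ x → ∃ λ y → y ∈ p × y ≢ x
2≤∣p∣⇒another {p = p} 2≤∣p∣ x = pick (element p c₀ Fin.≟ x)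
  where
  c₀ c₁ : Fin ∣ p ∣
  c₀ = fromℕ< (≤-trans (s≤s z≤n) 2≤∣p∣)
  c₁ = fromℕ< 2≤∣p∣
  c₀≢c₁ : c₀ ≢ c₁
  c₀≢c₁ c₀≡c₁ = 0≢1+n (trans (sym (Finₚ.toℕ-fromℕ< _)) (trans (cong toℕ c₀≡c₁) (Finₚ.toℕ-fromℕ< _)))
  pick : Dec (element p c₀ ≡ x) → ∃ λ y → y ∈ p × y ≢ x
  pick (yes c₀↦x) = element p c₁ , element-∈ p c₁ , λ c₁↦x → c₀≢c₁ (element-injective p (trans c₀↦x (sym c₁↦x)))
  pick (no c₀↛x) = element p c₀ , element-∈ p c₀ , c₀↛x

module Cyclic (n' : ℕ) where

  n : ℕ
  n = suc n'

  private
    wrap : ∀ a → n ≤ a → a < n + n → a % n + n ≡ a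
    wrap a n≤a a<2n = begin
      a % n + n        ≡⟨ cong (_+ n) (sym (m≤n⇒[n∸m]%m≡n%m n≤a)) ⟩
      (a ∸ n) % n + n  ≡⟨ cong (_+ n) (m<n⇒m%n≡m (subst (a ∸ n <_) (m+n∸n≡m n n) (∸-monoˡ-< a<2n n≤a))) ⟩
      a ∸ n + n        ≡⟨ m∸n+n≡m n≤a ⟩
      a                ∎
      where open ≡-Reasoning

  abstract
    offset : Fin n → Fin n → ℕ
    offset x y = (toℕ y + (n ∸ toℕ x)) % n

    shift : Fin n → ℕ → Fin n
    shift x o = fromℕ< (m%n<n (toℕ x + o) n)

    offset<n : ∀ x y → offset x y < n
    offset<n x y = m%n<n (toℕ y + (n ∸ toℕ x)) n

    toℕ-shift : ∀ x o → toℕ (shift x o) ≡ (toℕ x + o) % n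
    toℕ-shift x o = Finₚ.toℕ-fromℕ< _

    offset-≤ : ∀ x y → toℕ x ≤ toℕ y → offset x y + toℕ x ≡ toℕ y
    offset-≤ x y x≤y = begin
      (toℕ y + (n ∸ toℕ x)) % n + toℕ x  ≡⟨ cong (λ t → t % n + toℕ x) rearrange ⟩
      (toℕ y ∸ toℕ x + n) % n + toℕ x    ≡⟨ cong (_+ toℕ x) ([m+n]%n≡m%n (toℕ y ∸ toℕ x) n) ⟩
      (toℕ y ∸ toℕ x) % n + toℕ x        ≡⟨ cong (_+ toℕ x) (m<n⇒m%n≡m (≤-<-trans (m∸n≤m (toℕ y) (toℕ x)) (Finₚ.toℕ<n y))) ⟩
      toℕ y ∸ toℕ x + toℕ x              ≡⟨ m∸n+n≡m x≤y ⟩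
      toℕ y                              ∎
      where
      open ≡-Reasoning
      rearrange : toℕ y + (n ∸ toℕ x) ≡ toℕ y ∸ toℕ x + n
      rearrange = trans (sym (+-∸-assoc (toℕ y) (<⇒≤ (Finₚ.toℕ<n x)))) (+-∸-comm n x≤y)

    offset-> : ∀ x y → toℕ y < toℕ x → offset x y + toℕ x ≡ toℕ y + n
    offset-> x y y<x = begin
      (toℕ y + (n ∸ toℕ x)) % n + toℕ x  ≡⟨ cong (_+ toℕ x) (m<n⇒m%n≡m below-n) ⟩
      toℕ y + (n ∸ toℕ x) + toℕ x        ≡⟨ +-assoc (toℕ y) _ _ ⟩
      toℕ y + ((n ∸ toℕ x) + toℕ x)      ≡⟨ cong (toℕ y +_) (m∸n+n≡m (<⇒≤ (Finₚ.toℕ<n x))) ⟩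
      toℕ y + n                          ∎
      where
      open ≡-Reasoning
      below-n : toℕ y + (n ∸ toℕ x) < n
      below-n = subst (toℕ y + (n ∸ toℕ x) <_) (m+[n∸m]≡n (<⇒≤ (Finₚ.toℕ<n x))) (+-monoˡ-< (n ∸ toℕ x) y<x)

    offset-injective : ∀ x {y z} → offset x y ≡ offset x z → y ≡ z
    offset-injective x {y} {z} eq with toℕ x ≤? toℕ y | toℕ x ≤? toℕ z
    ... | yes x≤y | yes x≤z = Finₚ.toℕ-injective (trans (sym (offset-≤ x y x≤y)) (trans (cong (_+ toℕ x) eq) (offset-≤ x z x≤z)))
    ... | no x≰y | no x≰z = Finₚ.toℕ-injective (+-cancelʳ-≡ n _ _
          (trans (sym (offset-> x y (≰⇒> x≰y))) (trans (cong (_+ toℕ x) eq) (offset-> x z (≰⇒> x≰z)))))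
    ... | yes x≤y | no x≰z = ⊥-elim (<⇒≱ (Finₚ.toℕ<n y) (subst (n ≤_) (sym y≡z+n) (m≤n+m n (toℕ z))))
      where
      y≡z+n : toℕ y ≡ toℕ z + n
      y≡z+n = trans (sym (offset-≤ x y x≤y)) (trans (cong (_+ toℕ x) eq) (offset-> x z (≰⇒> x≰z)))
    ... | no x≰y | yes x≤z = ⊥-elim (<⇒≱ (Finₚ.toℕ<n z) (subst (n ≤_) (sym z≡y+n) (m≤n+m n (toℕ y))))
      where
      z≡y+n : toℕ z ≡ toℕ y + n
      z≡y+n = trans (sym (offset-≤ x z x≤z)) (trans (cong (_+ toℕ x) (sym eq)) (offset-> x y (≰⇒> x≰y)))

    offset-self : ∀ x → offset x x ≡ 0
    offset-self x = +-cancelʳ-≡ (toℕ x) (offset x x) 0 (offset-≤ x x ≤-refl)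

    offset-shift : ∀ x {o} → o < n → offset x (shift x o) ≡ o
    offset-shift x {o} o<n with toℕ x + o <? n
    ... | yes x+o<n = +-cancelʳ-≡ (toℕ x) _ _
          (trans (offset-≤ x (shift x o) (subst (toℕ x ≤_) (sym shift≡) (m≤m+n (toℕ x) o))) (trans shift≡ (+-comm (toℕ x) o)))
      where
      shift≡ : toℕ (shift x o) ≡ toℕ x + o
      shift≡ = trans (toℕ-shift x o) (m<n⇒m%n≡m x+o<n)
    ... | no x+o≮n = +-cancelʳ-≡ (toℕ x) _ _ (trans (offset-> x (shift x o) shift<x) (trans shift≡ (+-comm (toℕ x) o)))
      where
      shift≡ : toℕ (shift x o) + n ≡ toℕ x + o
      shift≡ = trans (cong (_+ n) (toℕ-shift x o)) (wrap _ (≮⇒≥ x+o≮n) (+-mono-< (Finₚ.toℕ<n x) o<n))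
      shift<x : toℕ (shift x o) < toℕ x
      shift<x = +-cancelʳ-< n _ _ (subst (_< toℕ x + n) (sym shift≡) (+-monoʳ-< (toℕ x) o<n))

    shift-offset : ∀ x y → shift x (offset x y) ≡ y
    shift-offset x y = offset-injective x (offset-shift x (offset<n x y))

    offset-mod : ∀ x y v → (offset y v + offset x y) % n ≡ offset x v
    offset-mod x y v = begin
      (offset y v + offset x y) % n
        ≡⟨ sym (%-distribˡ-+ (toℕ v + (n ∸ toℕ y)) (toℕ y + (n ∸ toℕ x)) n) ⟩
      (toℕ v + (n ∸ toℕ y) + (toℕ y + (n ∸ toℕ x))) % n
        ≡⟨ cong (_% n) (regroup (toℕ v) (n ∸ toℕ y) (toℕ y) (n ∸ toℕ x)) ⟩
      (toℕ v + (n ∸ toℕ x) + ((n ∸ toℕ y) + toℕ y)) % n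
        ≡⟨ cong (λ t → (toℕ v + (n ∸ toℕ x) + t) % n) (m∸n+n≡m (<⇒≤ (Finₚ.toℕ<n y))) ⟩
      (toℕ v + (n ∸ toℕ x) + n) % n
        ≡⟨ [m+n]%n≡m%n (toℕ v + (n ∸ toℕ x)) n ⟩
      offset x v ∎
      where
      open ≡-Reasoning
      regroup : ∀ a b c d → a + b + (c + d) ≡ a + d + (b + c)
      regroup = solve-∀

  offset-add : ∀ x y v → (offset y v + offset x y ≡ offset x v) ⊎ (offset y v + offset x y ≡ offset x v + n)
  offset-add x y v with offset y v + offset x y <? n
  ... | yes sum<n = inj₁ (trans (sym (m<n⇒m%n≡m sum<n)) (offset-mod x y v))
  ... | no sum≮n = inj₂ (trans (sym (wrap _ (≮⇒≥ sum≮n) (+-mono-< (offset<n y v) (offset<n x y)))) (cong (_+ n) (offset-mod x y v)))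

  offset-between : ∀ x u v → offset x u ≤ offset x v → offset u v + offset x u ≡ offset x v
  offset-between x u v u≤v with offset-add x u v
  ... | inj₁ eq = eq
  ... | inj₂ eq = ⊥-elim (<⇒≱ (+-mono-<-≤ (offset<n u v) u≤v) (≤-reflexive (trans (+-comm n (offset x v)) (sym eq))))

  cdist-offset : ∀ u v → cdist n u v ≡ offset u v ⊓ (n ∸ offset u v)
  cdist-offset u v with toℕ u ≤? toℕ v
  ... | yes u≤v = cong (λ t → t ⊓ (n ∸ t)) (trans (m≤n⇒∣m-n∣≡n∸m u≤v) (sym offset≡))
    where
    offset≡ : offset u v ≡ toℕ v ∸ toℕ u
    offset≡ = trans (sym (m+n∸n≡m (offset u v) (toℕ u))) (cong (_∸ toℕ u) (offset-≤ u v u≤v))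
  ... | no u≰v = begin
      ∣ toℕ u - toℕ v ∣ ⊓ (n ∸ ∣ toℕ u - toℕ v ∣)   ≡⟨ cong (λ t → t ⊓ (n ∸ t)) ∣u-v∣≡ ⟩
      (n ∸ offset u v) ⊓ (n ∸ (n ∸ offset u v))     ≡⟨ cong ((n ∸ offset u v) ⊓_) (m∸[m∸n]≡n (<⇒≤ (offset<n u v))) ⟩
      (n ∸ offset u v) ⊓ offset u v                  ≡⟨ ⊓-comm _ _ ⟩
      offset u v ⊓ (n ∸ offset u v)                  ∎
    where
    open ≡-Reasoning
    v<u : toℕ v < toℕ u
    v<u = ≰⇒> u≰v
    gap+offset : toℕ u ∸ toℕ v + offset u v ≡ n
    gap+offset = +-cancelʳ-≡ (toℕ v) _ _ (begin
      toℕ u ∸ toℕ v + offset u v + toℕ v    ≡⟨ +-assoc (toℕ u ∸ toℕ v) _ _ ⟩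
      toℕ u ∸ toℕ v + (offset u v + toℕ v)  ≡⟨ cong (toℕ u ∸ toℕ v +_) (+-comm (offset u v) (toℕ v)) ⟩
      toℕ u ∸ toℕ v + (toℕ v + offset u v)  ≡⟨ sym (+-assoc (toℕ u ∸ toℕ v) _ _) ⟩
      toℕ u ∸ toℕ v + toℕ v + offset u v    ≡⟨ cong (_+ offset u v) (m∸n+n≡m (<⇒≤ v<u)) ⟩
      toℕ u + offset u v                    ≡⟨ +-comm (toℕ u) (offset u v) ⟩
      offset u v + toℕ u                    ≡⟨ offset-> u v v<u ⟩
      toℕ v + n                             ≡⟨ +-comm (toℕ v) n ⟩
      n + toℕ v                             ∎)
    ∣u-v∣≡ : ∣ toℕ u - toℕ v ∣ ≡ n ∸ offset u v
    ∣u-v∣≡ = trans (m≤n⇒∣n-m∣≡n∸m (<⇒≤ v<u)) (trans (sym (m+n∸n≡m (toℕ u ∸ toℕ v) (offset u v))) (cong (_∸ offset u v) gap+offset))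

  arcs-disjoint : ∀ {x x' v} → x ≢ x' → offset x v < offset x x' → offset x' v < offset x' x → ⊥
  arcs-disjoint {x} {x'} {v} x≢x' v<x' v<x with offset-add x x' v | offset-add x x' x
  ... | inj₁ eq | _ = <⇒≱ v<x' (subst (offset x x' ≤_) eq (m≤n+m _ _))
  ... | inj₂ _ | inj₁ eq = x≢x' (sym (offset-injective x (trans (m+n≡0⇒n≡0 (offset x' x) (trans eq (offset-self x))) (sym (offset-self x)))))
  ... | inj₂ eqv | inj₂ eqx = <⇒≱ (+-monoˡ-< (offset x x') v<x) (begin
      offset x' x + offset x x'  ≡⟨ trans eqx (cong (_+ n) (offset-self x)) ⟩
      n                          ≤⟨ m≤n+m n (offset x v) ⟩
      offset x v + n             ≡⟨ sym eqv ⟩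
      offset x' v + offset x x'  ∎)
    where open ≤-Reasoning

  record Next (I : Subset n) (x : Fin n) : Set where
    field
      next : Fin n
      next∈I : next ∈ I
      next≢x : next ≢ x
      next-nearest : ∀ {z} → z ∈ I → z ≢ x → offset x next ≤ offset x z

  next-exists : ∀ {I x} → (∃ λ y → y ∈ I × y ≢ x) → Next I x
  next-exists {I} {x} other with argmin (λ z → z ∈ I × z ≢ x) (λ z → (z ∈? I) ×-dec ¬? (z Fin.≟ x)) (offset x) other
  ... | y , (y∈I , y≢x) , y-min = record
    { next = y ; next∈I = y∈I ; next≢x = y≢x ; next-nearest = λ z∈I z≢x → y-min _ (z∈I , z≢x) }

module Neighbourhood (n' m : ℕ) where
  open Cyclic n'

  InN-refl : ∀ v → InN n m v v
  InN-refl v = subst (_≤ m) (sym (cong (λ t → t ⊓ (n ∸ t)) (∣n-n∣≡0 (toℕ v)))) z≤n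

  InN-sym : ∀ u v → InN n m u v → InN n m v u
  InN-sym u v = subst (_≤ m) (cong (λ t → t ⊓ (n ∸ t)) (∣-∣-comm (toℕ u) (toℕ v)))

  -- v is at most m steps after u, positions being offsets from x; in the second case the steps pass x.
  Close : Fin n → Fin n → Fin n → Set
  Close x u v = offset x v ≤ offset x u + m ⊎ n + offset x u ≤ offset x v + m

  InN⇒Close : ∀ x u v → offset x u ≤ offset x v → InN n m u v → Close x u v
  InN⇒Close x u v u≤v uv≤m with ⊓-sel (offset u v) (n ∸ offset u v)
  ... | inj₁ eq = inj₁ (begin
      offset x v               ≡⟨ sym (offset-between x u v u≤v) ⟩
      offset u v + offset x u  ≤⟨ +-monoˡ-≤ (offset x u) (subst (_≤ m) eq (subst (_≤ m) (cdist-offset u v) uv≤m)) ⟩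
      m + offset x u           ≡⟨ +-comm m (offset x u) ⟩
      offset x u + m           ∎)
    where open ≤-Reasoning
  ... | inj₂ eq = inj₂ (begin
      n + offset x u                 ≤⟨ +-monoˡ-≤ (offset x u) (m≤n+m∸n n (offset u v)) ⟩
      offset u v + (n ∸ offset u v) + offset x u
        ≤⟨ +-monoˡ-≤ (offset x u) (+-monoʳ-≤ (offset u v) (subst (_≤ m) eq (subst (_≤ m) (cdist-offset u v) uv≤m))) ⟩
      offset u v + m + offset x u    ≡⟨ xy∙z≈xz∙y +-commutativeSemigroup (offset u v) m (offset x u) ⟩
      offset u v + offset x u + m    ≡⟨ cong (_+ m) (offset-between x u v u≤v) ⟩
      offset x v + m                 ∎)
    where open ≤-Reasoning

  Close⇒InN : ∀ x u v → offset x u ≤ offset x v → Close x u v → InN n m u v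
  Close⇒InN x u v u≤v close = subst (_≤ m) (sym (cdist-offset u v)) (bound close)
    where
    d = offset u v
    d+u≡v : d + offset x u ≡ offset x v
    d+u≡v = offset-between x u v u≤v
    bound : Close x u v → d ⊓ (n ∸ d) ≤ m
    bound (inj₁ v≤u+m) = ≤-trans (m⊓n≤m d (n ∸ d))
      (+-cancelʳ-≤ (offset x u) d m (subst₂ _≤_ (sym d+u≡v) (+-comm (offset x u) m) v≤u+m))
    bound (inj₂ n+u≤v+m) = ≤-trans (m⊓n≤n d (n ∸ d)) (m≤n+o⇒m∸n≤o n d
      (+-cancelʳ-≤ (offset x u) n (d + m) (subst (n + offset x u ≤_) v+m≡ n+u≤v+m)))
      where
      v+m≡ : offset x v + m ≡ d + m + offset x u
      v+m≡ = trans (cong (_+ m) (sym d+u≡v)) (xy∙z≈xz∙y +-commutativeSemigroup d (offset x u) m)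

  InN-by-offset : ∀ x v → offset x v ≤ m ⊎ n ≤ offset x v + m → InN n m x v
  InN-by-offset x v close = Close⇒InN x x v (subst (_≤ offset x v) (sym (offset-self x)) z≤n) (rebase close)
    where
    rebase : offset x v ≤ m ⊎ n ≤ offset x v + m → Close x x v
    rebase (inj₁ v≤m) = inj₁ (subst (λ t → offset x v ≤ t + m) (sym (offset-self x)) v≤m)
    rebase (inj₂ n≤v+m) = inj₂ (subst (λ t → n + t ≤ offset x v + m) (sym (offset-self x)) (subst (_≤ offset x v + m) (sym (+-identityʳ n)) n≤v+m))

  module _ {I : Subset n} (ind : Independent n m I) where

    independent-InN : ∀ {x y} → x ∈ I → y ∈ I → InN n m x y → x ≡ y
    independent-InN {x} {y} x∈I y∈I xy with x Fin.≟ y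
    ... | yes x≡y = x≡y
    ... | no x≢y = ⊥-elim (ind x y x∈I y∈I (x≢y , xy))

    independent-apart : ∀ {x y} → x ∈ I → y ∈ I → y ≢ x → m < offset x y × offset x y + m < n
    independent-apart {x} {y} x∈I y∈I y≢x = ≰⇒> (λ near → apart (inj₁ near)) , ≰⇒> (λ near → apart (inj₂ near))
      where
      apart : ¬ (offset x y ≤ m ⊎ n ≤ offset x y + m)
      apart close = y≢x (sym (independent-InN x∈I y∈I (InN-by-offset x y close)))

InPN-unique : ∀ n m (S : List (Fin n)) {i j x} → InPN n m S i x → InPN n m S j x → i ≡ j
InPN-unique n m S {i} {j} (xi , before-i) (xj , before-j) with Finₚ.<-cmp i j
... | tri< i<j _ _ = ⊥-elim (before-j i i<j xi)
... | tri≈ _ i≡j _ = i≡j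
... | tri> _ _ j<i = ⊥-elim (before-i j j<i xj)

module LegalSequence (n' m : ℕ) {S : List (Fin (suc n'))} (legal : LegalDom (suc n') m S)
                     {I : Subset (suc n')} (I≡IS : ISEq (suc n') m S I) where
  open Cyclic n'
  open Neighbourhood n' m

  footprinter : ∀ {v} → v ∈ I → ∃ λ i → InPN n m S i v × lookup S i ≡ v
  footprinter {v} = Equivalence.to (I≡IS v)

  self-footprinted⇒∈I : ∀ {i} → InPN n m S i (lookup S i) → lookup S i ∈ I
  self-footprinted⇒∈I {i} pn = Equivalence.from (I≡IS (lookup S i)) (i , pn , refl)

  ∈I⇒self-footprinted : ∀ i → lookup S i ∈ I → InPN n m S i (lookup S i)
  ∈I⇒self-footprinted i v∈I with footprinter v∈I
  ... | i' , pn , eq = subst (λ k → InPN n m S k (lookup S i)) (Unique-lookup-injective (proj₁ legal) eq) pn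

  -- An I-vertex is its own witness, which keeps witnesses apart from the cells T p below.
  witness : ∀ i → ∃ λ x → InPN n m S i x × (lookup S i ∈ I → x ≡ lookup S i)
  witness i with lookup S i ∈? I
  ... | yes v∈I = lookup S i , ∈I⇒self-footprinted i v∈I , λ _ → refl
  ... | no v∉I = proj₁ (proj₂ (proj₂ legal) i) , proj₂ (proj₂ (proj₂ legal) i) , λ v∈I → ⊥-elim (v∉I v∈I)

  length+cells≤n : ∀ {k} (T : Fin k × Fin m → Fin n) → (∀ {p q} → T p ≡ T q → p ≡ q) →
                   (∀ p → ∃ λ i → InPN n m S i (T p) × lookup S i ∈ I × T p ≢ lookup S i) →
                   length S + k * m ≤ n
  length+cells≤n T T-inj T-extra = Cells-injection⇒≤ H H-inj
    where
    H : Cells (length S) _ m → Fin n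
    H (inj₁ i) = proj₁ (witness i)
    H (inj₂ p) = T p
    witness≢T : ∀ i p → proj₁ (witness i) ≢ T p
    witness≢T i p eq with T-extra p
    ... | j , pn , v∈I , T≢v = T≢v (begin
      T p                      ≡⟨ sym eq ⟩
      proj₁ (witness i)        ≡⟨ cong (λ k → proj₁ (witness k)) i≡j ⟩
      proj₁ (witness j)        ≡⟨ proj₂ (proj₂ (witness j)) v∈I ⟩
      lookup S j               ∎)
      where
      open ≡-Reasoning
      i≡j : i ≡ j
      i≡j = InPN-unique n m S (proj₁ (proj₂ (witness i))) (subst (InPN n m S j) (sym eq) pn)
    H-inj : ∀ {c c'} → H c ≡ H c' → c ≡ c'
    H-inj {inj₁ i} {inj₁ i'} eq =
      cong inj₁ (InPN-unique n m S (proj₁ (proj₂ (witness i))) (subst (InPN n m S i') (sym eq) (proj₁ (proj₂ (witness i')))))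
    H-inj {inj₁ i} {inj₂ p} eq = ⊥-elim (witness≢T i p eq)
    H-inj {inj₂ p} {inj₁ i} eq = ⊥-elim (witness≢T i p (sym eq))
    H-inj {inj₂ p} {inj₂ q} eq = cong inj₂ (T-inj eq)

  length+2m≤n : m + m < n → length S + 2 * m ≤ n
  length+2m≤n 2m<n = length+cells≤n T T-injective (λ p → i₀ , first-PN (T-dominated p) , s₀∈I , T≢s₀ p)
    where
    first = first-index (proj₁ (proj₁ (proj₂ legal) zero))
    i₀ : Fin (length S)
    i₀ = proj₁ first
    s₀ = lookup S i₀
    first-PN : ∀ {v} → InN n m s₀ v → InPN n m S i₀ v
    first-PN s₀↦v = s₀↦v , λ j j<i₀ _ → proj₂ first j j<i₀
    s₀∈I : s₀ ∈ I
    s₀∈I = self-footprinted⇒∈I (first-PN (InN-refl s₀))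
    m<n : m < n
    m<n = ≤-<-trans (m≤m+n m m) 2m<n
    side : Fin 2 × Fin m → ℕ
    side (zero , t) = suc (toℕ t)
    side (suc zero , t) = n ∸ suc (toℕ t)
    1+t<n : ∀ (t : Fin m) → suc (toℕ t) < n
    1+t<n t = ≤-<-trans (Finₚ.toℕ<n t) m<n
    m<n∸[1+t] : ∀ (t : Fin m) → m < n ∸ suc (toℕ t)
    m<n∸[1+t] t = +-cancelʳ-< (suc (toℕ t)) m _ (begin-strict
      m + suc (toℕ t)              ≤⟨ +-monoʳ-≤ m (Finₚ.toℕ<n t) ⟩
      m + m                        <⟨ 2m<n ⟩
      n                            ≡⟨ sym (m∸n+n≡m (<⇒≤ (1+t<n t))) ⟩
      n ∸ suc (toℕ t) + suc (toℕ t) ∎)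
      where open ≤-Reasoning
    side<n : ∀ p → side p < n
    side<n (zero , t) = 1+t<n t
    side<n (suc zero , t) = ∸-monoʳ-< {n} {suc (toℕ t)} {0} (s≤s z≤n) (<⇒≤ (1+t<n t))
    T : Fin 2 × Fin m → Fin n
    T p = shift s₀ (side p)
    offset-T : ∀ p → offset s₀ (T p) ≡ side p
    offset-T p = offset-shift s₀ (side<n p)
    side-injective : ∀ {p q} → side p ≡ side q → p ≡ q
    side-injective {zero , t} {zero , t'} eq = cong (zero ,_) (Finₚ.toℕ-injective (suc-injective eq))
    side-injective {zero , t} {suc zero , t'} eq = ⊥-elim (<⇒≱ (m<n∸[1+t] t') (subst (_≤ m) eq (Finₚ.toℕ<n t)))
    side-injective {suc zero , t} {zero , t'} eq = ⊥-elim (<⇒≱ (m<n∸[1+t] t) (subst (_≤ m) (sym eq) (Finₚ.toℕ<n t')))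
    side-injective {suc zero , t} {suc zero , t'} eq =
      cong (suc zero ,_) (Finₚ.toℕ-injective (suc-injective (∸-cancelˡ-≡ (<⇒≤ (1+t<n t)) (<⇒≤ (1+t<n t')) eq)))
    T-injective : ∀ {p q} → T p ≡ T q → p ≡ q
    T-injective {p} {q} eq = side-injective (trans (sym (offset-T p)) (trans (cong (offset s₀) eq) (offset-T q)))
    T≢s₀ : ∀ p → T p ≢ s₀
    T≢s₀ p eq = side≢0 p (trans (sym (offset-T p)) (trans (cong (offset s₀) eq) (offset-self s₀)))
      where
      side≢0 : ∀ p → side p ≢ 0
      side≢0 (suc zero , t) eq = <⇒≢ (≤-<-trans z≤n (m<n∸[1+t] t)) (sym eq)
    T-dominated : ∀ p → InN n m s₀ (T p)
    T-dominated (zero , t) = InN-by-offset s₀ _ (inj₁ (subst (_≤ m) (sym (offset-T (zero , t))) (Finₚ.toℕ<n t)))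
    T-dominated (suc zero , t) = InN-by-offset s₀ _ (inj₂ (subst (λ o → n ≤ o + m) (sym (offset-T (suc zero , t)))
      (subst (_≤ n ∸ suc (toℕ t) + m) (m∸n+n≡m (<⇒≤ (1+t<n t))) (+-monoʳ-≤ (n ∸ suc (toℕ t)) (Finₚ.toℕ<n t)))))

  record Gap (x : Fin n) (N : Next I x) : Set where
    field
      owner : Fin (length S)
      owner∈I : lookup S owner ∈ I
      cell : Fin m → Fin n
      cell-PN : ∀ t → InPN n m S owner (cell t)
      cell≢owner : ∀ t → cell t ≢ lookup S owner
      cell-inside : ∀ t → offset x (cell t) < offset x (Next.next N)
      cell-injective : ∀ {t t'} → cell t ≡ cell t' → t ≡ t'

  -- Nothing before e dominates the arc from x to y, so the entry at e is self-footprinted, hence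
  -- x or y, and privately dominates the m vertices of the arc next to it.
  module GapConstruction (ind : Independent n m I) {x} (x∈I : x ∈ I) (N : Next I x) where
    open Next N renaming (next to y; next∈I to y∈I)

    d : ℕ
    d = offset x y

    m<d : m < d
    m<d = proj₁ (independent-apart ind x∈I y∈I next≢x)

    InArc : Fin (length S) → Set
    InArc i = offset x (lookup S i) ≤ d

    private
      ix = proj₁ (footprinter x∈I)
      iy = proj₁ (footprinter y∈I)

      x-undominated-before : ∀ j → j Fin.< ix → ¬ InN n m (lookup S j) x
      x-undominated-before = proj₂ (proj₁ (proj₂ (footprinter x∈I)))

      y-undominated-before : ∀ j → j Fin.< iy → ¬ InN n m (lookup S j) y
      y-undominated-before = proj₂ (proj₁ (proj₂ (footprinter y∈I)))

      ix-in-arc : InArc ix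
      ix-in-arc = subst (_≤ d) (sym (trans (cong (offset x) (proj₂ (proj₂ (footprinter x∈I)))) (offset-self x))) z≤n

      iy-in-arc : InArc iy
      iy-in-arc = ≤-reflexive (cong (offset x) (proj₂ (proj₂ (footprinter y∈I))))

      first-in-arc = argmin InArc (λ i → offset x (lookup S i) ≤? d) toℕ (ix , ix-in-arc)

    e : Fin (length S)
    e = proj₁ first-in-arc

    e-in-arc : InArc e
    e-in-arc = proj₁ (proj₂ first-in-arc)

    e-first : ∀ i → InArc i → toℕ e ≤ toℕ i
    e-first = proj₂ (proj₂ first-in-arc)

    arc-undominated-before-e : ∀ {z} → offset x z ≤ d → ∀ j → j Fin.< e → ¬ InN n m (lookup S j) z
    arc-undominated-before-e {z} z≤d j j<e u↦z with offset x (lookup S j) ≤? d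
    ... | yes u-in-arc = <⇒≱ j<e (e-first j u-in-arc)
    ... | no u∉arc with InN⇒Close x z (lookup S j) (≤-trans z≤d (<⇒≤ (≰⇒> u∉arc))) (InN-sym (lookup S j) z u↦z)
    ... | inj₁ u≤z+m = y-undominated-before j (<-≤-trans j<e (e-first iy iy-in-arc))
          (InN-sym y (lookup S j) (Close⇒InN x y (lookup S j) (<⇒≤ (≰⇒> u∉arc)) (inj₁ (≤-trans u≤z+m (+-monoˡ-≤ m z≤d)))))
    ... | inj₂ n+z≤u+m = x-undominated-before j (<-≤-trans j<e (e-first ix ix-in-arc))
          (InN-sym x (lookup S j) (InN-by-offset x (lookup S j) (inj₂ (≤-trans (m≤m+n n (offset x z)) n+z≤u+m))))

    owner∈I : lookup S e ∈ I
    owner∈I = self-footprinted⇒∈I (InN-refl (lookup S e) , arc-undominated-before-e e-in-arc)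

    owner-x-or-y : lookup S e ≡ x ⊎ lookup S e ≡ y
    owner-x-or-y with lookup S e Fin.≟ x
    ... | yes owner≡x = inj₁ owner≡x
    ... | no owner≢x = inj₂ (offset-injective x (≤-antisym e-in-arc (next-nearest owner∈I owner≢x)))

    cells-at : (o : Fin m → ℕ) → (∀ t → 0 < o t) → (∀ t → o t < d) → (∀ {t t'} → o t ≡ o t' → t ≡ t') →
               (∀ t → InN n m (lookup S e) (shift x (o t))) → Gap x N
    cells-at o o-pos o<d o-inj dominated = record
      { owner = e ; owner∈I = owner∈I ; cell = cell
      ; cell-PN = λ t → dominated t , arc-undominated-before-e (<⇒≤ (cell-inside t))
      ; cell≢owner = cell≢owner ; cell-inside = cell-inside
      ; cell-injective = λ {t} {t'} eq → o-inj (trans (sym (offset-cell t)) (trans (cong (offset x) eq) (offset-cell t'))) }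
      where
      cell : Fin m → Fin n
      cell t = shift x (o t)
      offset-cell : ∀ t → offset x (cell t) ≡ o t
      offset-cell t = offset-shift x (<-trans (o<d t) (offset<n x y))
      cell-inside : ∀ t → offset x (cell t) < d
      cell-inside t = subst (_< d) (sym (offset-cell t)) (o<d t)
      cell≢owner : ∀ t → cell t ≢ lookup S e
      cell≢owner t eq with owner-x-or-y
      ... | inj₁ owner≡x = <⇒≢ (o-pos t) (sym (trans (sym (offset-cell t)) (trans (cong (offset x) (trans eq owner≡x)) (offset-self x))))
      ... | inj₂ owner≡y = <⇒≢ (cell-inside t) (cong (offset x) (trans eq owner≡y))

    1+t<d : ∀ (t : Fin m) → suc (toℕ t) < d
    1+t<d t = ≤-<-trans (Finₚ.toℕ<n t) m<d

    d∸[1+t]<d : ∀ (t : Fin m) → d ∸ suc (toℕ t) < d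
    d∸[1+t]<d t = ∸-monoʳ-< {d} {suc (toℕ t)} {0} (s≤s z≤n) (<⇒≤ (1+t<d t))

    x-dominates-after : ∀ (t : Fin m) → InN n m x (shift x (suc (toℕ t)))
    x-dominates-after t = InN-by-offset x (shift x (suc (toℕ t)))
      (inj₁ (subst (_≤ m) (sym (offset-shift x (<-trans (1+t<d t) (offset<n x y)))) (Finₚ.toℕ<n t)))

    y-dominates-before : ∀ (t : Fin m) → InN n m y (shift x (d ∸ suc (toℕ t)))
    y-dominates-before t = InN-sym v y (Close⇒InN x v y (subst (_≤ d) (sym offset-v) (<⇒≤ (d∸[1+t]<d t)))
      (inj₁ (subst (λ o → d ≤ o + m) (sym offset-v)
        (subst (_≤ d ∸ suc (toℕ t) + m) (m∸n+n≡m (<⇒≤ (1+t<d t))) (+-monoʳ-≤ _ (Finₚ.toℕ<n t))))))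
      where
      v = shift x (d ∸ suc (toℕ t))
      offset-v : offset x v ≡ d ∸ suc (toℕ t)
      offset-v = offset-shift x (<-trans (d∸[1+t]<d t) (offset<n x y))

    gap : Gap x N
    gap with owner-x-or-y
    ... | inj₁ owner≡x = cells-at (λ t → suc (toℕ t)) (λ _ → s≤s z≤n) 1+t<d
            (λ eq → Finₚ.toℕ-injective (suc-injective eq))
            (λ t → subst (λ w → InN n m w (shift x (suc (toℕ t)))) (sym owner≡x) (x-dominates-after t))
    ... | inj₂ owner≡y = cells-at (λ t → d ∸ suc (toℕ t)) (λ t → m<n⇒0<n∸m (1+t<d t)) d∸[1+t]<d
            (λ {t} {t'} eq → Finₚ.toℕ-injective (suc-injective (∸-cancelˡ-≡ (<⇒≤ (1+t<d t)) (<⇒≤ (1+t<d t')) eq)))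
            (λ t → subst (λ w → InN n m w (shift x (d ∸ suc (toℕ t)))) (sym owner≡y) (y-dominates-before t))

  Gap-disjoint : ∀ {x x'} {N : Next I x} {N' : Next I x'} → x ∈ I → x' ∈ I → x ≢ x' →
                 (G : Gap x N) (G' : Gap x' N') → ∀ t t' → Gap.cell G t ≢ Gap.cell G' t'
  Gap-disjoint {x} {x'} {N} {N'} x∈I x'∈I x≢x' G G' t t' eq = arcs-disjoint x≢x'
    (<-≤-trans (Gap.cell-inside G t) (Next.next-nearest N x'∈I (λ x'≡x → x≢x' (sym x'≡x))))
    (subst (λ v → offset x' v < offset x' x) (sym eq) (<-≤-trans (Gap.cell-inside G' t') (Next.next-nearest N' x∈I x≢x')))

  length+∣I∣m≤n : Independent n m I → 2 ≤ ∣ I ∣ → length S + ∣ I ∣ * m ≤ n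
  length+∣I∣m≤n ind 2≤∣I∣ = length+cells≤n T T-injective T-extra
    where
    x : Fin ∣ I ∣ → Fin n
    x c = element I c
    N : ∀ c → Next I (x c)
    N c = next-exists (2≤∣p∣⇒another 2≤∣I∣ (x c))
    G : ∀ c → Gap (x c) (N c)
    G c = GapConstruction.gap ind (element-∈ I c) (N c)
    T : Fin ∣ I ∣ × Fin m → Fin n
    T (c , t) = Gap.cell (G c) t
    T-injective : ∀ {p q} → T p ≡ T q → p ≡ q
    T-injective {c , t} {c' , t'} eq with c Fin.≟ c'
    ... | yes refl = cong (c ,_) (Gap.cell-injective (G c) eq)
    ... | no c≢c' = ⊥-elim (Gap-disjoint (element-∈ I c) (element-∈ I c') (λ eq' → c≢c' (element-injective I eq')) (G c) (G c') t t' eq)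
    T-extra : ∀ p → ∃ λ i → InPN n m S i (T p) × lookup S i ∈ I × T p ≢ lookup S i
    T-extra (c , t) = Gap.owner (G c) , Gap.cell-PN (G c) t , Gap.owner∈I (G c) , Gap.cell≢owner (G c) t

module Run (n' m : ℕ) (1≤m : 1 ≤ m) (x₀ : Fin (suc n')) (2m<n : m + m < suc n') where
  open Cyclic n'
  open Neighbourhood n' m

  2m≡m+m : 2 * m ≡ m + m
  2m≡m+m = cong (m +_) (+-identityʳ m)

  K : ℕ
  K = n ∸ 2 * m

  K+2m≡n : K + (m + m) ≡ n
  K+2m≡n = trans (cong (K +_) (sym 2m≡m+m)) (m∸n+n≡m (subst (_≤ n) (sym 2m≡m+m) (<⇒≤ 2m<n)))

  0<K : 0 < K
  0<K = m<n⇒0<n∸m (subst (_< n) (sym 2m≡m+m) 2m<n)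

  o<K⇒o+2m<n : ∀ {o} → o < K → o + (m + m) < n
  o<K⇒o+2m<n {o} o<K = subst (o + (m + m) <_) K+2m≡n (+-monoˡ-< (m + m) o<K)

  o<K⇒o+m<n : ∀ {o} → o < K → o + m < n
  o<K⇒o+m<n {o} o<K = ≤-<-trans (+-monoʳ-≤ o (m≤m+n m m)) (o<K⇒o+2m<n o<K)

  run : List (Fin n)
  run = applyUpTo (shift x₀) K

  toℕ<K : ∀ (i : Fin (length run)) → toℕ i < K
  toℕ<K i = subst (toℕ i <_) (length-applyUpTo (shift x₀) K) (Finₚ.toℕ<n i)

  offset-run : ∀ i → offset x₀ (lookup run i) ≡ toℕ i
  offset-run i = trans (cong (offset x₀) (lookup-applyUpTo (shift x₀) K i))
    (offset-shift x₀ (≤-<-trans (m≤m+n (toℕ i) m) (o<K⇒o+m<n (toℕ<K i))))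

  position : ∀ {o} → o < K → ∃ λ (i : Fin (length run)) → offset x₀ (lookup run i) ≡ o
  position {o} o<K = i , trans (offset-run i) (Finₚ.toℕ-fromℕ< _)
    where i = fromℕ< (subst (o <_) (sym (length-applyUpTo (shift x₀) K)) o<K)

  run-unique : Unique run
  run-unique = Uniqueₚ.applyUpTo⁺₁ (shift x₀) K λ {i} {j} i<j j<K eq → <⇒≢ i<j (begin
    i                        ≡⟨ sym (offset-shift x₀ (<-trans i<j (≤-<-trans (m≤m+n j m) (o<K⇒o+m<n j<K)))) ⟩
    offset x₀ (shift x₀ i)   ≡⟨ cong (offset x₀) eq ⟩
    offset x₀ (shift x₀ j)   ≡⟨ offset-shift x₀ (≤-<-trans (m≤m+n j m) (o<K⇒o+m<n j<K)) ⟩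
    j                        ∎)
    where open ≡-Reasoning

  run-PN : ∀ i → ∃ λ w → InPN n m run i w
  run-PN i = w , dominated , undominated-before
    where
    o = toℕ i
    w = shift x₀ (o + m)
    offset-w : offset x₀ w ≡ o + m
    offset-w = offset-shift x₀ (o<K⇒o+m<n (toℕ<K i))
    dominated : InN n m (lookup run i) w
    dominated = Close⇒InN x₀ (lookup run i) w (subst₂ _≤_ (sym (offset-run i)) (sym offset-w) (m≤m+n o m))
      (inj₁ (subst₂ (λ a b → a ≤ b + m) (sym offset-w) (sym (offset-run i)) ≤-refl))
    undominated-before : ∀ j → j Fin.< i → ¬ InN n m (lookup run j) w
    undominated-before j j<i j↦w
      with InN⇒Close x₀ (lookup run j) w (subst₂ _≤_ (sym (offset-run j)) (sym offset-w) (≤-trans (<⇒≤ j<i) (m≤m+n o m))) j↦w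
    ... | inj₁ w≤j+m = <⇒≱ j<i (+-cancelʳ-≤ m o (toℕ j) (subst₂ (λ a b → a ≤ b + m) offset-w (offset-run j) w≤j+m))
    ... | inj₂ n+j≤w+m = <⇒≱ (subst (_< n) (sym (+-assoc o m m)) (o<K⇒o+2m<n (toℕ<K i)))
          (≤-trans (m≤m+n n (toℕ j)) (subst₂ (λ a b → n + a ≤ b + m) (offset-run j) offset-w n+j≤w+m))

  i₀ : Fin (length run)
  i₀ = proj₁ (position 0<K)

  run-head : lookup run i₀ ≡ x₀
  run-head = offset-injective x₀ (trans (proj₂ (position 0<K)) (sym (offset-self x₀)))

  run-dominating : ∀ z → ∃ λ i → InN n m (lookup run i) z
  run-dominating z with offset x₀ z <? K + m
  ... | yes z<K+m = i , Close⇒InN x₀ (lookup run i) z (subst (_≤ offset x₀ z) (sym offset-i) (m∸n≤m (offset x₀ z) m))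
                         (inj₁ (subst (λ a → offset x₀ z ≤ a + m) (sym offset-i) (subst (offset x₀ z ≤_) (+-comm m _) (m≤n+m∸n (offset x₀ z) m))))
    where
    behind = position (m<n+o⇒m∸n<o (offset x₀ z) m {{>-nonZero 0<K}} (subst (offset x₀ z <_) (+-comm K m) z<K+m))
    i = proj₁ behind
    offset-i = proj₂ behind
  ... | no z≮K+m = i₀ , subst (λ v → InN n m v z) (sym run-head) (InN-by-offset x₀ z (inj₂ (begin
      n                    ≡⟨ sym K+2m≡n ⟩
      K + (m + m)          ≡⟨ sym (+-assoc K m m) ⟩
      K + m + m            ≤⟨ +-monoˡ-≤ m (≮⇒≥ z≮K+m) ⟩
      offset x₀ z + m      ∎)))
    where open ≤-Reasoning

  run-long : n ≤ length run + 2 * m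
  run-long = ≤-reflexive (trans (sym K+2m≡n) (cong₂ _+_ (sym (length-applyUpTo (shift x₀) K)) (sym 2m≡m+m)))

  run-legal : LegalDom n m run
  run-legal = run-unique , run-dominating , run-PN

  run-ISEq : ∀ {I : Subset n} → x₀ ∈ I → (∀ {z} → z ∈ I → z ≡ x₀) → ISEq n m run I
  run-ISEq {I} x₀∈I only-x₀ z = mk⇔ to from
    where
    to : z ∈ I → InIS n m run z
    to z∈I = i₀ , (subst (InN n m (lookup run i₀)) head≡z (InN-refl (lookup run i₀)) , λ j j<i₀ → ⊥-elim (<⇒≱ j<i₀ i₀≤j)) , head≡z
      where
      head≡z : lookup run i₀ ≡ z
      head≡z = trans run-head (sym (only-x₀ z∈I))
      i₀≤j : ∀ {j} → toℕ i₀ ≤ toℕ j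
      i₀≤j {j} = subst (_≤ toℕ j) (sym (trans (sym (offset-run i₀)) (proj₂ (position 0<K)))) z≤n
    from : InIS n m run z → z ∈ I
    from (i , (_ , undominated-before) , i↦z) with toℕ i ≟ 0
    ... | yes i≡0 = subst (_∈ I) (trans (sym (offset-injective x₀ (trans (offset-run i) (trans i≡0 (sym (offset-self x₀)))))) i↦z) x₀∈I
    ... | no i≢0 = ⊥-elim (undominated-before j j<i (subst (InN n m (lookup run j)) i↦z j↦i))
      where
      predecessor = position (≤-<-trans pred[n]≤n (toℕ<K i))
      j = proj₁ predecessor
      offset-j : offset x₀ (lookup run j) ≡ pred (toℕ i)
      offset-j = proj₂ predecessor
      j<i : j Fin.< i
      j<i = subst (_< toℕ i) (sym (trans (sym (offset-run j)) offset-j)) (m≤pred[n]⇒suc[m]≤n {{≢-nonZero i≢0}} ≤-refl)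
      j↦i : InN n m (lookup run j) (lookup run i)
      j↦i = Close⇒InN x₀ (lookup run j) (lookup run i) (subst₂ _≤_ (sym offset-j) (sym (offset-run i)) pred[n]≤n)
        (inj₁ (subst₂ (λ a b → a ≤ b + m) (sym (offset-run i)) (sym offset-j)
          (subst (_≤ pred (toℕ i) + m) (trans (+-comm (pred (toℕ i)) 1) (suc-pred (toℕ i) {{≢-nonZero i≢0}})) (+-monoʳ-≤ (pred (toℕ i)) 1≤m))))

-- Offsets from x₀ are played in the order 0, 1, …, d − 1, n − 1, n − 2, …, d (the order Before),
-- where d is the offset of the nearest other I-vertex y₀, skipping the m offsets below d and
-- every offset beyond d that lies within m after an I-vertex.
module Spread (n' m : ℕ) (1≤m : 1 ≤ m) {I : Subset (suc n')} (ind : Independent (suc n') m I)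
              {x₀ : Fin (suc n')} (x₀∈I : x₀ ∈ I) (N : Cyclic.Next n' I x₀) where
  open Cyclic n'
  open Neighbourhood n' m
  open Next N renaming (next to y₀; next∈I to y₀∈I; next≢x to y₀≢x₀; next-nearest to y₀-nearest)

  o : Fin n → ℕ
  o = offset x₀

  d : ℕ
  d = o y₀

  m<d : m < d
  m<d = proj₁ (independent-apart ind x₀∈I y₀∈I y₀≢x₀)

  d+m<n : d + m < n
  d+m<n = proj₂ (independent-apart ind x₀∈I y₀∈I y₀≢x₀)

  d<n : d < n
  d<n = offset<n x₀ y₀

  0<d : 0 < d
  0<d = ≤-<-trans z≤n m<d

  o≡0⇒x₀ : ∀ {z} → o z ≡ 0 → z ≡ x₀
  o≡0⇒x₀ oz≡0 = offset-injective x₀ (trans oz≡0 (sym (offset-self x₀)))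

  Shadowed : ℕ → Set
  Shadowed k = ∃ λ z → z ∈ I × o z < k × k ≤ o z + m

  Shadowed? : ∀ k → Dec (Shadowed k)
  Shadowed? k = Finₚ.any? (λ z → (z ∈? I) ×-dec (o z <? k) ×-dec (k ≤? o z + m))

  Chosen : ℕ → Set
  Chosen k = k + m < d ⊎ (d ≤ k × ¬ Shadowed k)

  Chosen? : ∀ k → Dec (Chosen k)
  Chosen? k = (k + m <? d) ⊎-dec ((d ≤? k) ×-dec ¬? (Shadowed? k))

  Before : ℕ → ℕ → Set
  Before a b = (a < b × b < d) ⊎ (a < d × d ≤ b) ⊎ (d ≤ b × b < a)

  Before-irrefl : ∀ a → ¬ Before a a
  Before-irrefl a (inj₁ (a<a , _)) = <-irrefl refl a<a
  Before-irrefl a (inj₂ (inj₁ (a<d , d≤a))) = <⇒≱ a<d d≤a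
  Before-irrefl a (inj₂ (inj₂ (_ , a<a))) = <-irrefl refl a<a

  Before-asym : ∀ a b → Before a b → ¬ Before b a
  Before-asym a b (inj₁ (a<b , _)) (inj₁ (b<a , _)) = <-asym a<b b<a
  Before-asym a b (inj₁ (a<b , b<d)) (inj₂ (inj₁ (_ , d≤a))) = <⇒≱ (<-trans a<b b<d) d≤a
  Before-asym a b (inj₁ (a<b , b<d)) (inj₂ (inj₂ (d≤a , _))) = <⇒≱ (<-trans a<b b<d) d≤a
  Before-asym a b (inj₂ (inj₁ (_ , d≤b))) (inj₁ (b<a , a<d)) = <⇒≱ (<-trans b<a a<d) d≤b
  Before-asym a b (inj₂ (inj₁ (a<d , _))) (inj₂ (inj₁ (_ , d≤a))) = <⇒≱ a<d d≤a
  Before-asym a b (inj₂ (inj₁ (a<d , _))) (inj₂ (inj₂ (d≤a , _))) = <⇒≱ a<d d≤a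
  Before-asym a b (inj₂ (inj₂ (d≤b , _))) (inj₁ (b<a , a<d)) = <⇒≱ (<-trans b<a a<d) d≤b
  Before-asym a b (inj₂ (inj₂ (d≤b , _))) (inj₂ (inj₁ (b<d , _))) = <⇒≱ b<d d≤b
  Before-asym a b (inj₂ (inj₂ (_ , b<a))) (inj₂ (inj₂ (_ , a<b))) = <-asym a<b b<a

  Before-low : ∀ {a b} → Before a b → b < d → a < b
  Before-low (inj₁ (a<b , _)) _ = a<b
  Before-low (inj₂ (inj₁ (_ , d≤b))) b<d = ⊥-elim (<⇒≱ b<d d≤b)
  Before-low (inj₂ (inj₂ (d≤b , _))) b<d = ⊥-elim (<⇒≱ b<d d≤b)

  Before-high : ∀ {a b} → Before a b → d ≤ b → a < d ⊎ (d ≤ a × b < a)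
  Before-high (inj₁ (_ , b<d)) d≤b = ⊥-elim (<⇒≱ b<d d≤b)
  Before-high (inj₂ (inj₁ (a<d , _))) _ = inj₁ a<d
  Before-high (inj₂ (inj₂ (_ , b<a))) d≤b = inj₂ (≤-trans d≤b (<⇒≤ b<a) , b<a)

  traversal : List (Fin n)
  traversal = applyUpTo (shift x₀) d ++ applyUpTo (λ k → shift x₀ (n ∸ suc k)) (n ∸ d)

  private
    n∸[1+k]<n : ∀ {k} → k < n ∸ d → n ∸ suc k < n
    n∸[1+k]<n k<n∸d = ∸-monoʳ-< (s≤s z≤n) (≤-trans k<n∸d (m∸n≤m n d))

    d≤n∸[1+k] : ∀ {k} → k < n ∸ d → d ≤ n ∸ suc k
    d≤n∸[1+k] {k} k<n∸d = m+n≤o⇒m≤o∸n d (subst (_≤ n) (+-comm (suc k) d) (m≤o∸n⇒m+n≤o (suc k) (<⇒≤ d<n) k<n∸d))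

  traversal-sorted : AllPairs (λ u v → Before (o u) (o v)) traversal
  traversal-sorted = AllPairsₚ.++⁺
    (AllPairsₚ.applyUpTo⁺₁ (shift x₀) d λ i<j j<d →
      subst₂ Before (sym (offset-shift x₀ (<-trans i<j (<-trans j<d d<n)))) (sym (offset-shift x₀ (<-trans j<d d<n))) (inj₁ (i<j , j<d)))
    (AllPairsₚ.applyUpTo⁺₁ _ (n ∸ d) λ {i} {j} i<j j<n∸d →
      subst₂ Before (sym (offset-shift x₀ (n∸[1+k]<n (<-trans i<j j<n∸d)))) (sym (offset-shift x₀ (n∸[1+k]<n j<n∸d)))
        (inj₂ (inj₂ (d≤n∸[1+k] j<n∸d , ∸-monoʳ-< (s≤s i<j) (≤-trans j<n∸d (m∸n≤m n d))))))
    (Allₚ.applyUpTo⁺₁ (shift x₀) d λ a<d → Allₚ.applyUpTo⁺₁ _ (n ∸ d) λ b<n∸d →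
      subst₂ Before (sym (offset-shift x₀ (<-trans a<d d<n))) (sym (offset-shift x₀ (n∸[1+k]<n b<n∸d)))
        (inj₂ (inj₁ (a<d , d≤n∸[1+k] b<n∸d))))

  traversal-complete : ∀ v → v ∈ₗ traversal
  traversal-complete v with o v <? d
  ... | yes v<d = ∈-++⁺ˡ (subst (_∈ₗ applyUpTo (shift x₀) d) (shift-offset x₀ v) (∈-applyUpTo⁺ (shift x₀) v<d))
  ... | no v≮d = ∈-++⁺ʳ (applyUpTo (shift x₀) d) (subst (_∈ₗ applyUpTo _ (n ∸ d)) (trans (cong (shift x₀) back) (shift-offset x₀ v))
      (∈-applyUpTo⁺ (λ k → shift x₀ (n ∸ suc k)) (∸-monoʳ-< (s≤s (≮⇒≥ v≮d)) (offset<n x₀ v))))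
    where
    back : n ∸ suc (n ∸ suc (o v)) ≡ o v
    back = trans (cong (n ∸_) (sym (+-∸-assoc 1 (offset<n x₀ v)))) (m∸[m∸n]≡n (<⇒≤ (offset<n x₀ v)))

  spread : List (Fin n)
  spread = filter (λ v → Chosen? (o v)) traversal

  s : Fin (length spread) → Fin n
  s = lookup spread

  spread-Chosen : ∀ i → Chosen (o (s i))
  spread-Chosen i = All.lookup (Allₚ.all-filter (λ v → Chosen? (o v)) traversal) (∈-lookup i)

  Chosen⇒∈spread : ∀ {v} → Chosen (o v) → ∃ λ i → s i ≡ v
  Chosen⇒∈spread {v} chosen = Any.index v∈ , sym (lookup-index v∈)
    where
    v∈ : v ∈ₗ spread
    v∈ = ∈-filter⁺ (λ v → Chosen? (o v)) (traversal-complete v) chosen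

  spread-sorted : ∀ {j i} → j Fin.< i → Before (o (s j)) (o (s i))
  spread-sorted = AllPairs-lookup (AllPairsₚ.filter⁺ (λ v → Chosen? (o v)) traversal-sorted)

  Before⇒< : ∀ j i → Before (o (s j)) (o (s i)) → j Fin.< i
  Before⇒< j i before with Finₚ.<-cmp j i
  ... | tri< j<i _ _ = j<i
  ... | tri≈ _ refl _ = ⊥-elim (Before-irrefl _ before)
  ... | tri> _ _ i<j = ⊥-elim (Before-asym _ _ before (spread-sorted i<j))

  spread-unique : Unique spread
  spread-unique = AllPairs.map (λ {u} before u≡v → Before-irrefl (o u) (subst (λ w → Before (o u) (o w)) (sym u≡v) before))
    (AllPairsₚ.filter⁺ (λ v → Chosen? (o v)) traversal-sorted)

  Chosen-low : ∀ {a} → Chosen a → a < d → a + m < d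
  Chosen-low (inj₁ a+m<d) _ = a+m<d
  Chosen-low (inj₂ (d≤a , _)) a<d = ⊥-elim (<⇒≱ a<d d≤a)

  Chosen-high : ∀ {a} → Chosen a → d ≤ a → ¬ Shadowed a
  Chosen-high {a} (inj₁ a+m<d) d≤a = ⊥-elim (<⇒≱ (≤-<-trans (m≤m+n a m) a+m<d) d≤a)
  Chosen-high (inj₂ (_ , unshadowed)) _ = unshadowed

  PN-low : ∀ i → o (s i) + m < d → ∃ λ w → InPN n m spread i w
  PN-low i a+m<d = w , dominated , undominated-before
    where
    a = o (s i)
    w = shift x₀ (a + m)
    offset-w : o w ≡ a + m
    offset-w = offset-shift x₀ (<-trans a+m<d d<n)
    dominated : InN n m (s i) w
    dominated = Close⇒InN x₀ (s i) w (subst (a ≤_) (sym offset-w) (m≤m+n a m)) (inj₁ (subst (_≤ a + m) (sym offset-w) ≤-refl))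
    undominated-before : ∀ j → j Fin.< i → ¬ InN n m (s j) w
    undominated-before j j<i j↦w
      with Before-low (spread-sorted j<i) (≤-<-trans (m≤m+n a m) a+m<d)
    ... | b<a with InN⇒Close x₀ (s j) w (subst (o (s j) ≤_) (sym offset-w) (≤-trans (<⇒≤ b<a) (m≤m+n a m))) j↦w
    ... | inj₁ w≤b+m = <⇒≱ b<a (+-cancelʳ-≤ m a (o (s j)) (subst (_≤ o (s j) + m) offset-w w≤b+m))
    ... | inj₂ n+b≤w+m = <⇒≱ (<-trans (+-monoˡ-< m a+m<d) d+m<n)
          (≤-trans (m≤m+n n (o (s j))) (subst (λ t → n + o (s j) ≤ t + m) offset-w n+b≤w+m))

  PN-own : ∀ i → d ≤ o (s i) → s i ∈ I → InPN n m spread i (s i)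
  PN-own i d≤a u∈I = InN-refl (s i) , undominated-before
    where
    a = o (s i)
    u≢x₀ : s i ≢ x₀
    u≢x₀ u≡x₀ = <⇒≱ 0<d (subst (d ≤_) (trans (cong o u≡x₀) (offset-self x₀)) d≤a)
    far = independent-apart ind x₀∈I u∈I u≢x₀
    undominated-before : ∀ j → j Fin.< i → ¬ InN n m (s j) (s i)
    undominated-before j j<i j↦u with Before-high (spread-sorted j<i) d≤a
    ... | inj₁ b<d with InN⇒Close x₀ (s j) (s i) (≤-trans (<⇒≤ b<d) d≤a) j↦u
    ... | inj₁ a≤b+m = <⇒≱ (≤-<-trans a≤b+m (Chosen-low (spread-Chosen j) b<d)) d≤a
    ... | inj₂ n+b≤a+m = <⇒≱ (proj₂ far) (≤-trans (m≤m+n n (o (s j))) n+b≤a+m)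
    undominated-before j j<i j↦u | inj₂ (d≤b , a<b) with InN⇒Close x₀ (s i) (s j) (<⇒≤ a<b) (InN-sym (s j) (s i) j↦u)
    ... | inj₁ b≤a+m = Chosen-high (spread-Chosen j) d≤b (s i , u∈I , a<b , b≤a+m)
    ... | inj₂ n+a≤b+m = <⇒≱ (+-mono-< (offset<n x₀ (s j)) (proj₁ far)) n+a≤b+m

  PN-high : ∀ i → d ≤ o (s i) → s i ∉ I → ∃ λ w → InPN n m spread i w
  PN-high i d≤a u∉I = w , dominated , undominated-before
    where
    a = o (s i)
    d+m<a : d + m < a
    d+m<a with a ≤? d + m
    ... | no a≰d+m = ≰⇒> a≰d+m
    ... | yes a≤d+m = ⊥-elim (Chosen-high (spread-Chosen i) d≤a (y₀ , y₀∈I , ≤∧≢⇒< d≤a d≢a , a≤d+m))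
      where
      d≢a : d ≢ a
      d≢a d≡a = u∉I (subst (_∈ I) (offset-injective x₀ d≡a) y₀∈I)
    w = shift x₀ (a ∸ m)
    a∸m+m≡a : a ∸ m + m ≡ a
    a∸m+m≡a = m∸n+n≡m (≤-trans (m≤n+m m d) (<⇒≤ d+m<a))
    d<a∸m : d < a ∸ m
    d<a∸m = +-cancelʳ-< m d (a ∸ m) (subst (d + m <_) (sym a∸m+m≡a) d+m<a)
    offset-w : o w ≡ a ∸ m
    offset-w = offset-shift x₀ (≤-<-trans (m∸n≤m a m) (offset<n x₀ (s i)))
    dominated : InN n m (s i) w
    dominated = InN-sym w (s i) (Close⇒InN x₀ w (s i) (subst (_≤ a) (sym offset-w) (m∸n≤m a m))
      (inj₁ (subst (λ t → a ≤ t + m) (sym offset-w) (≤-reflexive (sym a∸m+m≡a)))))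
    undominated-before : ∀ j → j Fin.< i → ¬ InN n m (s j) w
    undominated-before j j<i j↦w with Before-high (spread-sorted j<i) d≤a
    ... | inj₁ b<d with InN⇒Close x₀ (s j) w (subst (o (s j) ≤_) (sym offset-w) (<⇒≤ (<-trans b<d d<a∸m))) j↦w
    ... | inj₁ w≤b+m = <⇒≱ (<-trans (Chosen-low (spread-Chosen j) b<d) d<a∸m) (subst (_≤ o (s j) + m) offset-w w≤b+m)
    ... | inj₂ n+b≤w+m = <⇒≱ (offset<n x₀ (s i))
          (≤-trans (m≤m+n n (o (s j))) (subst (n + o (s j) ≤_) (trans (cong (_+ m) offset-w) a∸m+m≡a) n+b≤w+m))
    undominated-before j j<i j↦w | inj₂ (d≤b , a<b)
      with InN⇒Close x₀ w (s j) (subst (_≤ o (s j)) (sym offset-w) (≤-trans (m∸n≤m a m) (<⇒≤ a<b))) (InN-sym (s j) w j↦w)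
    ... | inj₁ b≤w+m = <⇒≱ a<b (subst (o (s j) ≤_) (trans (cong (_+ m) offset-w) a∸m+m≡a) b≤w+m)
    ... | inj₂ n+w≤b+m = <⇒≱ (+-mono-< (offset<n x₀ (s j)) (<-trans m<d d<a∸m)) (subst (λ t → n + t ≤ o (s j) + m) offset-w n+w≤b+m)

  spread-PN : ∀ i → ∃ λ w → InPN n m spread i w
  spread-PN i with spread-Chosen i | s i ∈? I
  ... | inj₁ a+m<d | _ = PN-low i a+m<d
  ... | inj₂ (d≤a , _) | yes u∈I = s i , PN-own i d≤a u∈I
  ... | inj₂ (d≤a , _) | no u∉I = PN-high i d≤a u∉I

  ∈I⇒Chosen : ∀ {z} → z ∈ I → Chosen (o z)
  ∈I⇒Chosen {z} z∈I with z Fin.≟ x₀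
  ... | yes z≡x₀ = inj₁ (subst (λ a → a + m < d) (sym (trans (cong o z≡x₀) (offset-self x₀))) m<d)
  ... | no z≢x₀ = inj₂ (y₀-nearest z∈I z≢x₀ , λ { (z' , z'∈I , z'<z , z≤z'+m) →
        <-irrefl (cong o (independent-InN ind z'∈I z∈I (Close⇒InN x₀ z' z (<⇒≤ z'<z) (inj₁ z≤z'+m)))) z'<z })

  ∈I⇒∈spread : ∀ {z} → z ∈ I → ∃ λ i → s i ≡ z
  ∈I⇒∈spread z∈I = Chosen⇒∈spread (∈I⇒Chosen z∈I)

  spread-dominating : ∀ v → ∃ λ i → InN n m (s i) v
  spread-dominating v with Chosen? (o v)
  ... | yes chosen with Chosen⇒∈spread chosen
  ... | i , sᵢ≡v = i , subst (λ u → InN n m u v) (sym sᵢ≡v) (InN-refl v)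
  spread-dominating v | no unchosen with o v <? d
  ... | yes v<d with ∈I⇒∈spread y₀∈I
  ... | i , sᵢ≡y₀ = i , subst (λ u → InN n m u v) (sym sᵢ≡y₀)
        (InN-sym v y₀ (Close⇒InN x₀ v y₀ (<⇒≤ v<d) (inj₁ (≮⇒≥ (λ v+m<d → unchosen (inj₁ v+m<d))))))
  spread-dominating v | no unchosen | no v≮d with Shadowed? (o v)
  ... | no unshadowed = ⊥-elim (unchosen (inj₂ (≮⇒≥ v≮d , unshadowed)))
  ... | yes (z , z∈I , z<v , v≤z+m) with ∈I⇒∈spread z∈I
  ... | i , sᵢ≡z = i , subst (λ u → InN n m u v) (sym sᵢ≡z) (Close⇒InN x₀ z v (<⇒≤ z<v) (inj₁ v≤z+m))

  ∈I⇒self-PN : ∀ i → s i ∈ I → InPN n m spread i (s i)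
  ∈I⇒self-PN i u∈I with spread-Chosen i
  ... | inj₂ (d≤a , _) = PN-own i d≤a u∈I
  ... | inj₁ a+m<d = InN-refl (s i) , λ j j<i _ →
        <⇒≱ (Before-low (spread-sorted j<i) (≤-<-trans (m≤m+n (o (s i)) m) a+m<d)) (subst (_≤ o (s j)) (sym a≡0) z≤n)
    where
    a≡0 : o (s i) ≡ 0
    a≡0 with s i Fin.≟ x₀
    ... | yes u≡x₀ = trans (cong o u≡x₀) (offset-self x₀)
    ... | no u≢x₀ = ⊥-elim (<⇒≱ (≤-<-trans (m≤m+n (o (s i)) m) a+m<d) (y₀-nearest u∈I u≢x₀))

  ∉I⇒dominated-before : ∀ i → s i ∉ I → ∃ λ j → j Fin.< i × InN n m (s j) (s i)
  ∉I⇒dominated-before i u∉I with spread-Chosen i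
  ... | inj₁ a+m<d = j , Before⇒< j i (inj₁ (subst (_< a) (sym offset-j) pred<a , ≤-<-trans (m≤m+n a m) a+m<d)) ,
        Close⇒InN x₀ (s j) (s i) (subst (_≤ a) (sym offset-j) pred[n]≤n)
          (inj₁ (subst (λ t → a ≤ t + m) (sym offset-j) (subst (_≤ pred a + m) (trans (+-comm (pred a) 1) (suc-pred a {{nz}})) (+-monoʳ-≤ (pred a) 1≤m))))
    where
    a = o (s i)
    nz = ≢-nonZero (λ a≡0 → u∉I (subst (_∈ I) (sym (o≡0⇒x₀ a≡0)) x₀∈I))
    pred<a : pred a < a
    pred<a = m≤pred[n]⇒suc[m]≤n {{nz}} ≤-refl
    predecessor = Chosen⇒∈spread {shift x₀ (pred a)}
      (inj₁ (subst (λ t → t + m < d) (sym (offset-shift x₀ (<-trans pred<a (offset<n x₀ (s i))))) (≤-<-trans (+-monoˡ-≤ m pred[n]≤n) a+m<d)))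
    j = proj₁ predecessor
    offset-j : o (s j) ≡ pred a
    offset-j = trans (cong o (proj₂ predecessor)) (offset-shift x₀ (<-trans pred<a (offset<n x₀ (s i))))
  ... | inj₂ (d≤a , unshadowed) with suc (o (s i)) <? n
  ... | yes 1+a<n = j , Before⇒< j i (inj₂ (inj₂ (d≤a , subst (o (s i) <_) (sym offset-j) (n<1+n (o (s i)))))) ,
        InN-sym (s i) (s j) (Close⇒InN x₀ (s i) (s j) (subst (o (s i) ≤_) (sym offset-j) (n≤1+n (o (s i))))
          (inj₁ (subst (_≤ o (s i) + m) (sym offset-j) (subst (_≤ o (s i) + m) (+-comm (o (s i)) 1) (+-monoʳ-≤ (o (s i)) 1≤m)))))
    where
    a = o (s i)
    unshadowed′ : ¬ Shadowed (suc a)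
    unshadowed′ (z , z∈I , z<1+a , 1+a≤z+m) with o z ≟ a
    ... | yes z≡a = u∉I (subst (_∈ I) (offset-injective x₀ z≡a) z∈I)
    ... | no z≢a = unshadowed (z , z∈I , ≤∧≢⇒< (s≤s⁻¹ z<1+a) z≢a , ≤-trans (n≤1+n a) 1+a≤z+m)
    successor = Chosen⇒∈spread {shift x₀ (suc a)} (inj₂ (subst (d ≤_) (sym (offset-shift x₀ 1+a<n)) (≤-trans d≤a (n≤1+n a)) ,
                  subst (λ t → ¬ Shadowed t) (sym (offset-shift x₀ 1+a<n)) unshadowed′))
    j = proj₁ successor
    offset-j : o (s j) ≡ suc a
    offset-j = trans (cong o (proj₂ successor)) (offset-shift x₀ 1+a<n)
  ... | no 1+a≮n = j , Before⇒< j i (inj₂ (inj₁ (subst (_< d) (sym offset-j) 0<d , d≤a))) ,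
        subst (λ u → InN n m u (s i)) (sym (proj₂ head))
          (InN-by-offset x₀ (s i) (inj₂ (≤-trans (≮⇒≥ 1+a≮n) (subst (_≤ o (s i) + m) (+-comm (o (s i)) 1) (+-monoʳ-≤ (o (s i)) 1≤m)))))
    where
    head = ∈I⇒∈spread x₀∈I
    j = proj₁ head
    offset-j : o (s j) ≡ 0
    offset-j = trans (cong o (proj₂ head)) (offset-self x₀)

  spread-legal : LegalDom n m spread
  spread-legal = spread-unique , spread-dominating , spread-PN

  spread-ISEq : ISEq n m spread I
  spread-ISEq z = mk⇔ to from
    where
    to : z ∈ I → InIS n m spread z
    to z∈I with ∈I⇒∈spread z∈I
    ... | i , sᵢ≡z = i , subst (InPN n m spread i) sᵢ≡z (∈I⇒self-PN i (subst (_∈ I) (sym sᵢ≡z) z∈I)) , sᵢ≡z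
    from : InIS n m spread z → z ∈ I
    from (i , (_ , undominated-before) , sᵢ≡z) with z ∈? I
    ... | yes z∈I = z∈I
    ... | no z∉I with ∉I⇒dominated-before i (λ u∈I → z∉I (subst (_∈ I) sᵢ≡z u∈I))
    ... | j , j<i , j↦u = ⊥-elim (undominated-before j j<i (subst (InN n m (s j)) sᵢ≡z j↦u))

  private
    index-of : ∀ {z} → z ∈ I → Fin ∣ I ∣
    index-of z∈I = proj₁ (element-surjective I z∈I)

    before-y₀ : ∀ {a} → a < d → d ≤ a + m → a + m ∸ d < m
    before-y₀ {a} a<d d≤a+m = subst (a + m ∸ d <_) (m+n∸m≡n d m) (∸-monoˡ-< (+-monoˡ-< m a<d) d≤a+m)

    after : ∀ {a b} → b < a → a ≤ b + m → a ∸ suc b < m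
    after {a} {b} b<a a≤b+m = subst (a ∸ suc b <_) (m+n∸m≡n (suc b) m) (∸-monoˡ-< (s≤s a≤b+m) b<a)

  vertex-of : Cells (length spread) ∣ I ∣ m → Fin n
  vertex-of (inj₁ i) = s i
  vertex-of (inj₂ (c , t)) with element I c Fin.≟ x₀
  ... | yes _ = shift x₀ (d ∸ m + toℕ t)
  ... | no _ = shift x₀ (suc (o (element I c)) + toℕ t)

  vertex-of-x₀ : ∀ {c} t → element I c ≡ x₀ → vertex-of (inj₂ (c , t)) ≡ shift x₀ (d ∸ m + toℕ t)
  vertex-of-x₀ {c} t c↦x₀ with element I c Fin.≟ x₀
  ... | yes _ = refl
  ... | no c↛x₀ = ⊥-elim (c↛x₀ c↦x₀)

  vertex-of-other : ∀ {c} t → element I c ≢ x₀ → vertex-of (inj₂ (c , t)) ≡ shift x₀ (suc (o (element I c)) + toℕ t)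
  vertex-of-other {c} t c↛x₀ with element I c Fin.≟ x₀
  ... | yes c↦x₀ = ⊥-elim (c↛x₀ c↦x₀)
  ... | no _ = refl

  -- A skipped vertex below d is charged to x₀, any other one to an I-vertex that shadows it.
  cell-of : Fin n → Cells (length spread) ∣ I ∣ m
  cell-of v with Chosen? (o v)
  ... | yes chosen = inj₁ (proj₁ (Chosen⇒∈spread chosen))
  ... | no unchosen with o v <? d
  ... | yes v<d = inj₂ (index-of x₀∈I , fromℕ< (before-y₀ v<d (≮⇒≥ λ v+m<d → unchosen (inj₁ v+m<d))))
  ... | no v≮d with Shadowed? (o v)
  ... | no unshadowed = ⊥-elim (unchosen (inj₂ (≮⇒≥ v≮d , unshadowed)))
  ... | yes (z , z∈I , z<v , v≤z+m) = inj₂ (index-of z∈I , fromℕ< (after z<v v≤z+m))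

  vertex-of-cell-of : ∀ v → vertex-of (cell-of v) ≡ v
  vertex-of-cell-of v with Chosen? (o v)
  ... | yes chosen = proj₂ (Chosen⇒∈spread chosen)
  ... | no unchosen with o v <? d
  ... | yes v<d = trans (vertex-of-x₀ _ (proj₂ (element-surjective I x₀∈I))) (trans (cong (shift x₀) offset≡) (shift-offset x₀ v))
    where
    d≤v+m : d ≤ o v + m
    d≤v+m = ≮⇒≥ λ v+m<d → unchosen (inj₁ v+m<d)
    offset≡ : d ∸ m + toℕ (fromℕ< (before-y₀ v<d d≤v+m)) ≡ o v
    offset≡ = begin
      d ∸ m + toℕ (fromℕ< (before-y₀ v<d d≤v+m))  ≡⟨ cong (d ∸ m +_) (Finₚ.toℕ-fromℕ< _) ⟩
      d ∸ m + (o v + m ∸ d)                       ≡⟨ sym (+-∸-assoc (d ∸ m) d≤v+m) ⟩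
      d ∸ m + (o v + m) ∸ d                       ≡⟨ cong (_∸ d) (+-comm (d ∸ m) (o v + m)) ⟩
      o v + m + (d ∸ m) ∸ d                       ≡⟨ cong (_∸ d) (+-assoc (o v) m (d ∸ m)) ⟩
      o v + (m + (d ∸ m)) ∸ d                     ≡⟨ cong (λ t → o v + t ∸ d) (m+[n∸m]≡n (<⇒≤ m<d)) ⟩
      o v + d ∸ d                                 ≡⟨ m+n∸n≡m (o v) d ⟩
      o v                                         ∎
      where open ≡-Reasoning
  ... | no v≮d with Shadowed? (o v)
  ... | no unshadowed = ⊥-elim (unchosen (inj₂ (≮⇒≥ v≮d , unshadowed)))
  ... | yes (z , z∈I , z<v , v≤z+m) =
        trans (vertex-of-other _ c↛x₀) (trans (cong (shift x₀) offset≡) (shift-offset x₀ v))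
    where
    c↦z : element I (index-of z∈I) ≡ z
    c↦z = proj₂ (element-surjective I z∈I)
    c↛x₀ : element I (index-of z∈I) ≢ x₀
    c↛x₀ c↦x₀ = <⇒≱ (≤-<-trans (subst (λ t → o v ≤ t + m) (trans (cong o (trans (sym c↦z) c↦x₀)) (offset-self x₀)) v≤z+m) m<d) (≮⇒≥ v≮d)
    offset≡ : suc (o (element I (index-of z∈I))) + toℕ (fromℕ< (after z<v v≤z+m)) ≡ o v
    offset≡ = trans (cong₂ (λ a b → suc (o a) + b) c↦z (Finₚ.toℕ-fromℕ< _)) (m+[n∸m]≡n z<v)

  spread-long : n ≤ length spread + ∣ I ∣ * m
  spread-long = injection-Cells⇒≤ cell-of λ {v} {v'} eq →
    trans (sym (vertex-of-cell-of v)) (trans (cong vertex-of eq) (vertex-of-cell-of v'))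

GrundyEq-intro : ∀ {n m I k} (S₀ : List (Fin n)) → LegalDom n m S₀ → ISEq n m S₀ I → n ≤ length S₀ + k →
                 (∀ S → LegalDom n m S → ISEq n m S I → length S + k ≤ n) → GrundyEq n m I (n ∸ k)
GrundyEq-intro {n} {k = k} S₀ legal₀ iseq₀ n≤S₀+k upper =
  (S₀ , legal₀ , iseq₀ , trans (sym (m+n∸n≡m (length S₀) k)) (cong (_∸ k) S₀+k≡n)) ,
  λ S legal iseq → m+n≤o⇒m≤o∸n (length S) (upper S legal iseq)
  where
  S₀+k≡n : length S₀ + k ≡ n
  S₀+k≡n = ≤-antisym (upper S₀ legal₀ iseq₀) n≤S₀+k

grundy-single : ∀ n' m → 1 ≤ m → m + m < suc n' → ∀ {I : Subset (suc n')} → ∣ I ∣ ≡ 1 →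
                GrundyEq (suc n') m I (suc n' ∸ 2 * m)
grundy-single n' m 1≤m 2m<n {I} ∣I∣≡1 with ∣p∣≡1⇒singleton ∣I∣≡1
... | x₀ , x₀∈I , only-x₀ = GrundyEq-intro run run-legal (run-ISEq x₀∈I only-x₀) run-long
      (λ S legal iseq → LegalSequence.length+2m≤n n' m legal iseq 2m<n)
  where open Run n' m 1≤m x₀ 2m<n

grundy-many : ∀ n' m → 1 ≤ m → ∀ {I : Subset (suc n')} → Independent (suc n') m I → 2 ≤ ∣ I ∣ →
              GrundyEq (suc n') m I (suc n' ∸ ∣ I ∣ * m)
grundy-many n' m 1≤m {I} ind 2≤∣I∣ = GrundyEq-intro spread spread-legal spread-ISEq spread-long
  (λ S legal iseq → LegalSequence.length+∣I∣m≤n n' m legal iseq ind 2≤∣I∣)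
  where
  x₀∈I : element I (fromℕ< (≤-trans (s≤s z≤n) 2≤∣I∣)) ∈ I
  x₀∈I = element-∈ I _
  open Spread n' m 1≤m ind x₀∈I (Cyclic.next-exists n' (2≤∣p∣⇒another 2≤∣I∣ _))

private
  2[m+1]≡2+2m : ∀ m → 2 * (m + 1) ≡ suc (suc (m + m))
  2[m+1]≡2+2m = solve-∀

lemma5 : (m n : ℕ) → 1 ≤ m → n ≥ 2 * (m + 1) → (I : Subset n) → Independent n m I → 1 ≤ ∣ I ∣ →
    ((∣ I ∣ ≥ 2 → GrundyEq n m I (n ∸ ∣ I ∣ * m)) × (∣ I ∣ ≡ 1 → GrundyEq n m I (n ∸ 2 * m)))
lemma5 m n 1≤m n≥2m+2 I ind _ with subst (_≤ n) (2[m+1]≡2+2m m) n≥2m+2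
... | s≤s 1+2m≤n' = grundy-many _ m 1≤m ind , grundy-single _ m 1≤m (m≤n⇒m≤1+n 1+2m≤n')
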